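{- Let $(\mathcal K,r_n)$ and $(\mathcal K,r_n')$ be pre-extenders of the $n$-maniplex $\mathcal K$. The following are equivalent: (1) there is an isomorphism $\varphi:\mathcal U(\mathcal K,r_n)\to\mathcal U(\mathcal K,r_n')$; (2) there is a non-empty $(r_n,r_n')$-friendly set $S\subseteq\Gamma(\mathcal K)$; (3) there is an automorphism $\tau$ of $\mathcal K$ such that $\mathcal K_{r_n^\tau}/\heartsuit(\mathcal K,r_n)^\tau=\mathcal K_{r_n'}/\heartsuit(\mathcal K,r_n')$ (equality, not merely isomorphism, of quotient premaniplexes on the flag set of $\mathcal K$).
   Context: An $n$-premaniplex is a graph (semi-edges and parallel edges allowed) whose vertices, called flags, carry a proper edge colouring with colours $0,\dots,n-1$, each flag $\Phi$ having exactly one incident dart of each colour $i$, with other end $r_i\Phi$; one requires $r_ir_jr_ir_j=1$ for $|i-j|>1$. An $n$-maniplex is a connected $n$-premaniplex in which $r_i$ and $r_ir_j$ ($i\ne j$) have no fixed points. Facets are components after deleting colour-$(n-1)$ edges. Automorphisms are colour-preserving and act on the right; $\Gamma(\mathcal K)$ is the automorphism group. A pre-extender $(\mathcal K,r_n)$ is a permutation $r_n$ of the flags of $\mathcal K$ with $r_n^2=1$ commuting with $r_0,\dots,r_{n-2}$. The pre-extension $\mathcal K_{r_n}$ is the $(n+1)$-premaniplex with the flags and $i$-adjacencies ($i<n$) of $\mathcal K$ and $n$-adjacency $\Phi\mapsto r_n\Phi$. The universal Cayley extension $\mathcal U(\mathcal K,r_n)$ has flags $(\Phi,\gamma)$, $\gamma\in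 G(\mathcal K,r_n)=\langle\alpha_F\ (F\text{ a facet})\mid\alpha_F\alpha_{r_n(F)}=1\rangle$, with $(\Phi,\gamma)$ $i$-adjacent to $(r_i\Phi,\gamma)$ for $i<n$ and $n$-adjacent to $(r_n\Phi,\alpha_F\gamma)$, $F$ the facet of $\Phi$. For pre-extenders $r_n,r_n'$, a set $S\subseteq\Gamma(\mathcal K)$ is $(r_n,r_n')$-friendly if for every flag $\Phi$ and every $\tau\in S$ there is $\bar\tau\in S$ with $r_n'(\Phi\tau)=(r_n\Phi)\bar\tau$; $r_n$-friendly means $(r_n,r_n)$-friendly. $\heartsuit(\mathcal K,r_n)$ is the union of all $r_n$-friendly subsets of $\Gamma(\mathcal K)$ (a subgroup). For $\tau\in\Gamma(\mathcal K)$, $r_n^\tau(\Phi)=(r_n(\Phi\tau^{ -1}))\tau$ and $H^\tau=\tau^{ -1}H\tau$. For an $r_n$-friendly subgroup $H$, $\mathcal K_{r_n}/H$ is the premaniplex with vertices the orbits $\Phi H$, where $\Phi H$ is $i$-adjacent to $(r_i\Phi)H$ for $0\le i\le n$. -}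

module Defs where

open import Level using (Level; _⊔_) renaming (suc to lsuc)
open import Data.Nat using (ℕ; zero; suc; _+_; _<_; _≤_)
open import Data.Fin using (Fin; toℕ) renaming (zero to fzero; suc to fsuc)
open import Data.List using (List; []; _∷_; _++_)
open import Data.List.Relation.Unary.All using (All)
open import Data.Bool using (Bool; true; false)
open import Data.Product using (Σ; ∃; _×_; _,_; proj₁; proj₂)
open import Data.Sum using (_⊎_)
open import Relation.Binary.PropositionalEquality using (_≡_; _≢_)
open import Function using (_∘_)

FarApart : ∀ {n} → Fin n → Fin n → Set
FarApart i j = (toℕ i + 2 ≤ toℕ j) ⊎ (toℕ j + 2 ≤ toℕ i)

-- n-premaniplexes (flags with involutions r_i; semi-edges = fixed points)

record Premaniplex (n : ℕ) : Set₁ where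
  field
    Flag    : Set
    r       : Fin n → Flag → Flag
    r-invol : ∀ i Φ → r i (r i Φ) ≡ Φ
    r-comm  : ∀ i j → FarApart i j → ∀ Φ → r i (r j (r i (r j Φ))) ≡ Φ

  applyW : List (Fin n) → Flag → Flag
  applyW []      Φ = Φ
  applyW (i ∷ w) Φ = applyW w (r i Φ)

  FacetColour : Fin n → Set
  FacetColour i = suc (toℕ i) < n

  SameFacet : Flag → Flag → Set
  SameFacet Φ Ψ = Σ (List (Fin n)) λ w → All FacetColour w × applyW w Φ ≡ Ψ

record Maniplex (n : ℕ) : Set₁ where
  field
    pre : Premaniplex n
  open Premaniplex pre public
  field
    connected  : ∀ Φ Ψ → Σ (List (Fin n)) λ w → applyW w Φ ≡ Ψ
    r-nofix    : ∀ i Φ → r i Φ ≢ Φ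
    rr-nofix   : ∀ i j → i ≢ j → ∀ Φ → r i (r j Φ) ≢ Φ

module _ {n : ℕ} (K : Maniplex n) where
  open Maniplex K

  record PreExtender : Set where
    field
      rn       : Flag → Flag
      rn-invol : ∀ Φ → rn (rn Φ) ≡ Φ
      rn-comm  : ∀ i → FacetColour i → ∀ Φ → rn (r i Φ) ≡ r i (rn Φ)

  extCol : ∀ {m} {A : Set} → (Fin m → A) → A → Fin (suc m) → A
  extCol {zero}  f a fzero    = a
  extCol {suc m} f a fzero    = f fzero
  extCol {suc m} f a (fsuc i) = extCol (f ∘ fsuc) a i

  preExtR : (Flag → Flag) → Fin (suc n) → Flag → Flag
  preExtR s = extCol r s

  -- The group G(K, r_n) = < α_F | α_F α_{r_n F} = 1 >, presented by
  -- words in letters (b , Φ) meaning α_{facet of Φ}^{±1} (true = +1),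
  -- modulo the congruence generated by the group and defining relations.

  Word : Set
  Word = List (Bool × Flag)

  data _∼⟨_⟩_ : Word → PreExtender → Word → Set where
    ∼refl  : ∀ {P u} → u ∼⟨ P ⟩ u
    ∼sym   : ∀ {P u v} → u ∼⟨ P ⟩ v → v ∼⟨ P ⟩ u
    ∼trans : ∀ {P u v w} → u ∼⟨ P ⟩ v → v ∼⟨ P ⟩ w → u ∼⟨ P ⟩ w
    ∼cong  : ∀ {P u u' v v'} → u ∼⟨ P ⟩ u' → v ∼⟨ P ⟩ v' → (u ++ v) ∼⟨ P ⟩ (u' ++ v')
    ∼facet : ∀ {P b Φ Ψ} → SameFacet Φ Ψ → ((b , Φ) ∷ []) ∼⟨ P ⟩ ((b , Ψ) ∷ [])
    ∼invʳ  : ∀ {P Φ} → ((true , Φ) ∷ (false , Φ) ∷ []) ∼⟨ P ⟩ []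
    ∼invˡ  : ∀ {P Φ} → ((false , Φ) ∷ (true , Φ) ∷ []) ∼⟨ P ⟩ []
    ∼rel   : ∀ {P Φ} → ((true , Φ) ∷ (true , PreExtender.rn P Φ) ∷ []) ∼⟨ P ⟩ []

  -- The universal Cayley extension U(K, r_n), as a setoid of flags (Φ , γ)

  UFlag : Set
  UFlag = Flag × Word

  _≈U⟨_⟩_ : UFlag → PreExtender → UFlag → Set
  (Φ , u) ≈U⟨ P ⟩ (Ψ , v) = (Φ ≡ Ψ) × (u ∼⟨ P ⟩ v)

  rU : PreExtender → Fin (suc n) → UFlag → UFlag
  rU P = extCol (λ i x → (r i (proj₁ x) , proj₂ x))
                (λ x → (PreExtender.rn P (proj₁ x) , (true , proj₁ x) ∷ proj₂ x))

  record UIso (P P' : PreExtender) : Set where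
    field
      to       : UFlag → UFlag
      from     : UFlag → UFlag
      to-cong  : ∀ {x y} → x ≈U⟨ P ⟩ y → to x ≈U⟨ P' ⟩ to y
      from-cong : ∀ {x y} → x ≈U⟨ P' ⟩ y → from x ≈U⟨ P ⟩ from y
      to-from  : ∀ y → to (from y) ≈U⟨ P' ⟩ y
      from-to  : ∀ x → from (to x) ≈U⟨ P ⟩ x
      to-r     : ∀ i x → to (rU P i x) ≈U⟨ P' ⟩ rU P' i (to x)

  -- Automorphisms of K (acting on the right: Φτ = act τ Φ)

  record Aut : Set where
    field
      act     : Flag → Flag
      inv     : Flag → Flag
      act-inv : ∀ Φ → act (inv Φ) ≡ Φ
      inv-act : ∀ Φ → inv (act Φ) ≡ Φ
      act-r   : ∀ i Φ → act (r i Φ) ≡ r i (act Φ)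
  open Aut public

  Friendly : ∀ {ℓ} → (Flag → Flag) → (Flag → Flag) → (Aut → Set ℓ) → Set ℓ
  Friendly s s' S = ∀ Φ τ → S τ → Σ Aut λ τ̄ → S τ̄ × (s' (act τ Φ) ≡ act τ̄ (s Φ))

  Heart : PreExtender → Aut → Set₁
  Heart P τ = Σ (Aut → Set) λ S → Friendly (PreExtender.rn P) (PreExtender.rn P) S × S τ

  conjR : Aut → (Flag → Flag) → Flag → Flag
  conjR τ s Φ = act τ (s (inv τ Φ))

  ConjSet : ∀ {ℓ} → (Aut → Set ℓ) → Aut → Aut → Set ℓ
  ConjSet H τ σ = Σ Aut λ h → H h × (∀ Φ → act σ Φ ≡ act τ (act h (inv τ Φ)))

  InOrbit : ∀ {ℓ} → (Aut → Set ℓ) → Flag → Flag → Set ℓ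
  InOrbit H Φ Ψ = Σ Aut λ σ → H σ × (Ψ ≡ act σ Φ)

  -- Equality K_{s}/H = K_{s'}/H' of quotient premaniplexes on the flags of K:
  -- the same vertices (orbits) and, for every colour i ≤ n, the same
  -- i-adjacency ΦH ↦ (r_i Φ)H.
  QuotEq : ∀ {ℓ ℓ'} → (Flag → Flag) → (Aut → Set ℓ) → (Flag → Flag) → (Aut → Set ℓ') → Set (ℓ ⊔ ℓ')
  QuotEq s H s' H' =
    (∀ Φ Ψ → (InOrbit H Φ Ψ → InOrbit H' Φ Ψ) × (InOrbit H' Φ Ψ → InOrbit H Φ Ψ)) ×
    (∀ i Φ Ψ → (InOrbit H (preExtR s i Φ) Ψ → InOrbit H' (preExtR s' i Φ) Ψ)
             × (InOrbit H' (preExtR s' i Φ) Ψ → InOrbit H (preExtR s i Φ) Ψ))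

{-# OPTIONS --safe #-}
-- A friendly set S turns a flag (Φ , γ) of U(K, r_n) into one of U(K, r_n'): read γ
-- letter by letter starting from some τ ∈ S; a letter α_F, with Z a flag of F, replaces
-- the current σ by the σ̄ ∈ S with r_n'(Zσ) = (r_n Z)σ̄ and emits α_{facet of Zσ}.
-- This respects the defining relations of G(K, r_n), and the same construction for the
-- friendly set S⁻¹ gives the inverse. Conversely an isomorphism restricts on each copy
-- K × {γ} to an automorphism of K, and these automorphisms form a friendly set.
-- If τ lies in a friendly set S then ♡(K, r_n)^τ = ♡(K, r_n'), because S⁻¹ ♡ S and
-- S ♡' S⁻¹ are friendly; on n-adjacencies the two quotients then agree exactly when
-- r_n'(Φτ) ∈ (r_n Φ) τ ♡(K, r_n'), i.e. when the coset τ ♡(K, r_n') is friendly.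
module Submission where

open import Defs
open import Data.Nat using (ℕ)
open import Data.Product using (Σ; _×_)
open import Function.Bundles using (_⇔_)
open import Data.Bool using (Bool; true; false)
open import Data.Fin using (Fin; inject₁; fromℕ) renaming (zero to fzero; suc to fsuc)
open import Data.Fin.Relation.Unary.Top using (view; ‵fromℕ; ‵inject₁)
open import Data.List using (List; []; _∷_; _++_)
open import Data.List.Relation.Unary.All using (All; []; _∷_; universal)
open import Data.Nat using (zero; suc)
open import Data.Product using (_,_; proj₁; proj₂)
open import Data.Unit using (⊤; tt)
open import Function using (_∘_; id)
open import Function.Bundles using (mk⇔)
open import Level using (Level; _⊔_)
open import Relation.Binary.PropositionalEquality

private variable
  ℓ ℓ' ℓ'' : Level

module _ {n : ℕ} (K : Maniplex n) where
  open Maniplex K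
  open PreExtender
  open ≡-Reasoning

  extCol-inject₁ : ∀ {m} {A : Set} (f : Fin m → A) a j → extCol K f a (inject₁ j) ≡ f j
  extCol-inject₁ {suc m} f a fzero    = refl
  extCol-inject₁ {suc m} f a (fsuc j) = extCol-inject₁ (f ∘ fsuc) a j

  extCol-fromℕ : ∀ {m} {A : Set} (f : Fin m → A) a → extCol K f a (fromℕ m) ≡ a
  extCol-fromℕ {zero}  f a = refl
  extCol-fromℕ {suc m} f a = extCol-fromℕ (f ∘ fsuc) a

  preExtR-inject₁ : ∀ s j → preExtR K s (inject₁ j) ≡ r j
  preExtR-inject₁ s = extCol-inject₁ r s

  preExtR-fromℕ : ∀ s → preExtR K s (fromℕ n) ≡ s
  preExtR-fromℕ s = extCol-fromℕ r s

  rU-inject₁ : ∀ P j → rU K P (inject₁ j) ≡ λ x → r j (proj₁ x) , proj₂ x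
  rU-inject₁ P = extCol-inject₁ _ _

  rU-fromℕ : ∀ P → rU K P (fromℕ n) ≡ λ x → rn P (proj₁ x) , (true , proj₁ x) ∷ proj₂ x
  rU-fromℕ P = extCol-fromℕ {m = n} _ _

  infix 4 _≃_
  _≃_ : Aut K → Aut K → Set
  σ ≃ τ = act σ ≗ act τ

  1A : Aut K
  1A = record { act = id ; inv = id ; act-inv = λ _ → refl ; inv-act = λ _ → refl ; act-r = λ _ _ → refl }

  -- Automorphisms act on the right, so σ ∙ τ applies σ first.
  infixl 7 _∙_
  _∙_ : Aut K → Aut K → Aut K
  σ ∙ τ = record
    { act     = act τ ∘ act σ
    ; inv     = inv σ ∘ inv τ
    ; act-inv = λ Φ → trans (cong (act τ) (act-inv σ (inv τ Φ))) (act-inv τ Φ)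
    ; inv-act = λ Φ → trans (cong (inv σ) (inv-act τ (act σ Φ))) (inv-act σ Φ)
    ; act-r   = λ i Φ → trans (cong (act τ) (act-r σ i Φ)) (act-r τ i (act σ Φ))
    }

  inv-r : ∀ (σ : Aut K) i Φ → inv σ (r i Φ) ≡ r i (inv σ Φ)
  inv-r σ i Φ = begin
    inv σ (r i Φ)                  ≡⟨ cong (inv σ ∘ r i) (act-inv σ Φ) ⟨
    inv σ (r i (act σ (inv σ Φ)))  ≡⟨ cong (inv σ) (act-r σ i (inv σ Φ)) ⟨
    inv σ (act σ (r i (inv σ Φ)))  ≡⟨ inv-act σ _ ⟩
    r i (inv σ Φ)                  ∎

  infix 8 _⁻¹
  _⁻¹ : Aut K → Aut K
  σ ⁻¹ = record { act = inv σ ; inv = act σ ; act-inv = inv-act σ ; inv-act = act-inv σ ; act-r = inv-r σ }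

  Commutes : (Fin n → Set) → (Flag → Flag) → Set
  Commutes C f = ∀ i → C i → f ∘ r i ≗ r i ∘ f

  AllColours : Fin n → Set
  AllColours _ = ⊤

  act-commutes : ∀ {C} (σ : Aut K) → Commutes C (act σ)
  act-commutes σ i _ = act-r σ i

  ∘-commutes : ∀ {C f g} → Commutes C f → Commutes C g → Commutes C (f ∘ g)
  ∘-commutes {f = f} {g} cf cg i c Φ = trans (cong f (cg i c Φ)) (cf i c (g Φ))

  applyW-commutes : ∀ {C f w} → Commutes C f → All C w → f ∘ applyW w ≗ applyW w ∘ f
  applyW-commutes cf [] Φ = refl
  applyW-commutes {w = i ∷ w} cf (c ∷ cs) Φ =
    trans (applyW-commutes cf cs (r i Φ)) (cong (applyW w) (cf i c Φ))

  agree-along : ∀ {C f g w Φ} → Commutes C f → Commutes C g → All C w →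
                f Φ ≡ g Φ → f (applyW w Φ) ≡ g (applyW w Φ)
  agree-along {f = f} {g} {w} {Φ} cf cg cs e = begin
    f (applyW w Φ)  ≡⟨ applyW-commutes cf cs Φ ⟩
    applyW w (f Φ)  ≡⟨ cong (applyW w) e ⟩
    applyW w (g Φ)  ≡⟨ applyW-commutes cg cs Φ ⟨
    g (applyW w Φ)  ∎

  agree-on-facet : ∀ {f g Φ Ψ} → Commutes FacetColour f → Commutes FacetColour g →
                   f Φ ≡ g Φ → SameFacet Φ Ψ → f Ψ ≡ g Ψ
  agree-on-facet cf cg e (w , cs , refl) = agree-along cf cg cs e

  agree-everywhere : ∀ {f g Φ} → Commutes AllColours f → Commutes AllColours g → f Φ ≡ g Φ → f ≗ g
  agree-everywhere {Φ = Φ} cf cg e Ψ with connected Φ Ψ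
  ... | w , refl = agree-along cf cg (universal (λ _ → tt) w) e

  ≃-at-flag : ∀ (σ τ : Aut K) Φ → act σ Φ ≡ act τ Φ → σ ≃ τ
  ≃-at-flag σ τ Φ = agree-everywhere (act-commutes σ) (act-commutes τ)

  SameFacet-refl : ∀ {Φ} → SameFacet Φ Φ
  SameFacet-refl = [] , [] , refl

  SameFacet-map : ∀ {f Φ Ψ} → Commutes FacetColour f → SameFacet Φ Ψ → SameFacet (f Φ) (f Ψ)
  SameFacet-map cf (w , cs , refl) = w , cs , sym (applyW-commutes cf cs _)

  HasFriendlySet : (Flag → Flag) → (Flag → Flag) → Set₁
  HasFriendlySet s s' = Σ (Aut K → Set) λ S → Σ (Aut K) S × Friendly K s s' S

  Trivial : Aut K → Set
  Trivial σ = σ ≃ 1A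

  infixl 7 _⊙_
  _⊙_ : (Aut K → Set ℓ) → (Aut K → Set ℓ') → Aut K → Set (ℓ ⊔ ℓ')
  (A ⊙ B) σ = Σ (Aut K) λ α → Σ (Aut K) λ β → A α × B β × σ ≃ α ∙ β

  infix 8 _⁻¹ˢ
  _⁻¹ˢ : (Aut K → Set ℓ) → Aut K → Set ℓ
  (S ⁻¹ˢ) σ = Σ (Aut K) λ τ → S τ × σ ≃ τ ⁻¹

  Trivial-friendly : ∀ s → Friendly K s s Trivial
  Trivial-friendly s Φ σ σ≃1 = 1A , (λ _ → refl) , cong s (σ≃1 Φ)

  ⊙-friendly : ∀ s s' s'' {A : Aut K → Set ℓ} {B : Aut K → Set ℓ'} →
               Friendly K s s' A → Friendly K s' s'' B → Friendly K s s'' (A ⊙ B)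
  ⊙-friendly s s' s'' FA FB Φ σ (α , β , α∈A , β∈B , σ≃αβ)
    with FA Φ α α∈A | FB (act α Φ) β β∈B
  ... | ᾱ , ᾱ∈A , eα | β̄ , β̄∈B , eβ =
    ᾱ ∙ β̄ , (ᾱ , β̄ , ᾱ∈A , β̄∈B , λ _ → refl) , (begin
      s'' (act σ Φ)          ≡⟨ cong s'' (σ≃αβ Φ) ⟩
      s'' (act β (act α Φ))  ≡⟨ eβ ⟩
      act β̄ (s' (act α Φ))   ≡⟨ cong (act β̄) eα ⟩
      act β̄ (act ᾱ (s Φ))    ∎)

  ⁻¹ˢ-friendly : ∀ s s' {S : Aut K → Set ℓ} → Friendly K s s' S → Friendly K s' s (S ⁻¹ˢ)
  ⁻¹ˢ-friendly s s' F Ψ σ (τ , τ∈S , σ≃τ⁻¹) with F (inv τ Ψ) τ τ∈S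
  ... | τ̄ , τ̄∈S , e = τ̄ ⁻¹ , (τ̄ , τ̄∈S , λ _ → refl) , (begin
    s (act σ Ψ)                   ≡⟨ cong s (σ≃τ⁻¹ Ψ) ⟩
    s (inv τ Ψ)                   ≡⟨ inv-act τ̄ _ ⟨
    inv τ̄ (act τ̄ (s (inv τ Ψ)))   ≡⟨ cong (inv τ̄) e ⟨
    inv τ̄ (s' (act τ (inv τ Ψ)))  ≡⟨ cong (inv τ̄ ∘ s') (act-inv τ Ψ) ⟩
    inv τ̄ (s' Ψ)                  ∎)

  -- The automorphisms reachable from τ by iterating friendliness form a friendly set
  -- in Set, whatever the universe of T.
  small-friendly : ∀ s s' {T : Aut K → Set ℓ} {τ} → Friendly K s s' T → T τ → HasFriendlySet s s'
  small-friendly s s' {T} {τ} F τ∈T = Reachable , (τ , [] , refl) , reachable-friendly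
    where
    next : Flag → Σ (Aut K) T → Σ (Aut K) T
    next Φ (σ , σ∈T) = proj₁ (F Φ σ σ∈T) , proj₁ (proj₂ (F Φ σ σ∈T))

    walk : List Flag → Σ (Aut K) T
    walk []       = τ , τ∈T
    walk (Φ ∷ Φs) = next Φ (walk Φs)

    Reachable : Aut K → Set
    Reachable σ = Σ (List Flag) λ Φs → proj₁ (walk Φs) ≡ σ

    reachable-friendly : Friendly K s s' Reachable
    reachable-friendly Φ _ (Φs , refl) =
      proj₁ (walk (Φ ∷ Φs)) , (Φ ∷ Φs , refl) ,
      proj₂ (proj₂ (F Φ (proj₁ (walk Φs)) (proj₂ (walk Φs))))

  Heart-1 : ∀ P → Heart K P 1A
  Heart-1 P = Trivial , Trivial-friendly (rn P) , λ _ → refl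

  Heart-∙ : ∀ P {α β} → Heart K P α → Heart K P β → Heart K P (α ∙ β)
  Heart-∙ P (A , FA , α∈A) (B , FB , β∈B) =
    A ⊙ B , ⊙-friendly (rn P) (rn P) (rn P) FA FB , (_ , _ , α∈A , β∈B , λ _ → refl)

  Heart-⁻¹ : ∀ P {α} → Heart K P α → Heart K P (α ⁻¹)
  Heart-⁻¹ P (A , FA , α∈A) = A ⁻¹ˢ , ⁻¹ˢ-friendly (rn P) (rn P) FA , (_ , α∈A , λ _ → refl)

  SameOrbits : (Aut K → Set ℓ) → (Aut K → Set ℓ') → Flag → Flag → Set (ℓ ⊔ ℓ')
  SameOrbits H H' Φ Φ' =
    ∀ Ψ → (InOrbit K H Φ Ψ → InOrbit K H' Φ' Ψ) × (InOrbit K H' Φ' Ψ → InOrbit K H Φ Ψ)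

  SameOrbits-trans : ∀ {H : Aut K → Set ℓ} {H' : Aut K → Set ℓ'} {H'' : Aut K → Set ℓ''}
                     {Φ Φ' Φ''} →
                     SameOrbits H H' Φ Φ' → SameOrbits H' H'' Φ' Φ'' → SameOrbits H H'' Φ Φ''
  SameOrbits-trans p q Ψ = proj₁ (q Ψ) ∘ proj₁ (p Ψ) , proj₂ (p Ψ) ∘ proj₂ (q Ψ)

  same-orbits : ∀ {H : Aut K → Set ℓ} {H' : Aut K → Set ℓ'} →
                (∀ {σ} → H σ → H' σ) → (∀ {σ} → H' σ → H σ) → ∀ Φ → SameOrbits H H' Φ Φ
  same-orbits H⊆H' H'⊆H Φ Ψ =
    (λ (σ , σ∈H , e) → σ , H⊆H' σ∈H , e) , (λ (σ , σ∈H' , e) → σ , H'⊆H σ∈H' , e)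

  SameOrbits-Heart-act : ∀ P {ρ} → Heart K P ρ → ∀ Φ → SameOrbits (Heart K P) (Heart K P) Φ (act ρ Φ)
  SameOrbits-Heart-act P {ρ} ρ∈H Φ Ψ =
      (λ (σ , σ∈H , e) → ρ ⁻¹ ∙ σ , Heart-∙ P (Heart-⁻¹ P ρ∈H) σ∈H ,
                          trans e (cong (act σ) (sym (inv-act ρ Φ))))
    , (λ (σ , σ∈H , e) → ρ ∙ σ , Heart-∙ P ρ∈H σ∈H , e)

  QuotEq-intro : ∀ s s' {H : Aut K → Set ℓ} {H' : Aut K → Set ℓ'} →
                 (∀ Φ → SameOrbits H H' Φ Φ) → (∀ Φ → SameOrbits H H' (s Φ) (s' Φ)) →
                 QuotEq K s H s' H'
  QuotEq-intro s s' {H} {H'} low top = low , adjacency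
    where
    adjacency : ∀ i Φ → SameOrbits H H' (preExtR K s i Φ) (preExtR K s' i Φ)
    adjacency i Φ with view i
    ... | ‵fromℕ     rewrite preExtR-fromℕ s | preExtR-fromℕ s' = top Φ
    ... | ‵inject₁ j rewrite preExtR-inject₁ s j | preExtR-inject₁ s' j = low (r j Φ)

  QuotEq-top : ∀ s s' {H : Aut K → Set ℓ} {H' : Aut K → Set ℓ'} →
               QuotEq K s H s' H' → ∀ Φ → SameOrbits H H' (s Φ) (s' Φ)
  QuotEq-top s s' {H} {H'} (_ , adjacency) Φ =
    subst₂ (SameOrbits H H') (cong-app (preExtR-fromℕ s) Φ) (cong-app (preExtR-fromℕ s') Φ)
           (adjacency (fromℕ n) Φ)

  module _ (P P' : PreExtender K) {S : Aut K → Set} (F : Friendly K (rn P) (rn P') S)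
           {τ : Aut K} (τ∈S : S τ) where

    private
      F⁻¹ : Friendly K (rn P') (rn P) (S ⁻¹ˢ)
      F⁻¹ = ⁻¹ˢ-friendly (rn P) (rn P') F

    conj-Heart⊆Heart : ∀ {σ} → ConjSet K (Heart K P) τ σ → Heart K P' σ
    conj-Heart⊆Heart (h , (A , FA , h∈A) , σ≃) =
        S ⁻¹ˢ ⊙ A ⊙ S
      , ⊙-friendly (rn P') (rn P) (rn P') (⊙-friendly (rn P') (rn P) (rn P) F⁻¹ FA) F
      , (τ ⁻¹ ∙ h , τ , (τ ⁻¹ , h , (τ , τ∈S , λ _ → refl) , h∈A , λ _ → refl) , τ∈S , σ≃)

    Heart⊆conj-Heart : ∀ {σ} → Heart K P' σ → ConjSet K (Heart K P) τ σ
    Heart⊆conj-Heart {σ} (B , FB , σ∈B) =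
        τ ∙ σ ∙ τ ⁻¹
      , (S ⊙ B ⊙ S ⁻¹ˢ , ⊙-friendly (rn P) (rn P') (rn P) (⊙-friendly (rn P) (rn P') (rn P') F FB) F⁻¹
        , (τ ∙ σ , τ ⁻¹ , (τ , σ , τ∈S , σ∈B , λ _ → refl) , (τ , τ∈S , λ _ → refl) , λ _ → refl))
      , λ Φ → trans (cong (act σ) (sym (act-inv τ Φ))) (sym (act-inv τ _))

    conj-Heart-orbits : ∀ Φ → SameOrbits (ConjSet K (Heart K P) τ) (Heart K P') Φ Φ
    conj-Heart-orbits = same-orbits conj-Heart⊆Heart Heart⊆conj-Heart

    -- r_n'(Φ) = (r_n^τ Φ) τ⁻¹τ̄ with τ⁻¹τ̄ ∈ ♡(K, r_n'), by friendliness at Φτ⁻¹.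
    conj-top-orbits : ∀ Φ →
      SameOrbits (ConjSet K (Heart K P) τ) (Heart K P') (conjR K τ (rn P) Φ) (rn P' Φ)
    conj-top-orbits Φ with F (inv τ Φ) τ τ∈S
    ... | τ̄ , τ̄∈S , e =
      subst (SameOrbits (ConjSet K (Heart K P) τ) (Heart K P') (act τ X)) shift
        (SameOrbits-trans (conj-Heart-orbits (act τ X)) (SameOrbits-Heart-act P' τ⁻¹τ̄∈♡ (act τ X)))
      where
      X = rn P (inv τ Φ)

      τ⁻¹τ̄∈♡ : Heart K P' (τ ⁻¹ ∙ τ̄)
      τ⁻¹τ̄∈♡ = S ⁻¹ˢ ⊙ S , ⊙-friendly (rn P') (rn P) (rn P') F⁻¹ F
             , (τ ⁻¹ , τ̄ , (τ , τ∈S , λ _ → refl) , τ̄∈S , λ _ → refl)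

      shift : act τ̄ (inv τ (act τ X)) ≡ rn P' Φ
      shift = begin
        act τ̄ (inv τ (act τ X))    ≡⟨ cong (act τ̄) (inv-act τ X) ⟩
        act τ̄ X                    ≡⟨ e ⟨
        rn P' (act τ (inv τ Φ))    ≡⟨ cong (rn P') (act-inv τ Φ) ⟩
        rn P' Φ                    ∎

  friendly⇒QuotEq : ∀ P P' → HasFriendlySet (rn P) (rn P') →
    Σ (Aut K) λ τ → QuotEq K (conjR K τ (rn P)) (ConjSet K (Heart K P) τ) (rn P') (Heart K P')
  friendly⇒QuotEq P P' (S , (τ , τ∈S) , F) =
    τ , QuotEq-intro (conjR K τ (rn P)) (rn P') (conj-Heart-orbits P P' F τ∈S) (conj-top-orbits P P' F τ∈S)

  QuotEq⇒friendly : ∀ P P' →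
    Σ (Aut K) (λ τ → QuotEq K (conjR K τ (rn P)) (ConjSet K (Heart K P) τ) (rn P') (Heart K P')) →
    HasFriendlySet (rn P) (rn P')
  QuotEq⇒friendly P P' (τ , q) =
    small-friendly (rn P) (rn P') {τ = τ} coset-friendly (1A , Heart-1 P' , λ _ → refl)
    where
    Coset : Aut K → Set₁
    Coset σ = Σ (Aut K) λ k → Heart K P' k × σ ≃ τ ∙ k

    top-step : ∀ Φ → Σ (Aut K) λ j → Heart K P' j × rn P' (act τ Φ) ≡ act j (act τ (rn P Φ))
    top-step Φ with proj₁ (proj₁ q (conjR K τ (rn P) (act τ Φ)) (rn P' (act τ Φ)))
                      (proj₂ (QuotEq-top (conjR K τ (rn P)) (rn P') q (act τ Φ) (rn P' (act τ Φ)))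
                             (1A , Heart-1 P' , refl))
    ... | j , j∈♡ , e = j , j∈♡ , trans e (cong (act j ∘ act τ ∘ rn P) (inv-act τ Φ))

    coset-friendly : Friendly K (rn P) (rn P') Coset
    coset-friendly Φ σ (k , (B , FB , k∈B) , σ≃τk) with top-step Φ | FB (act τ Φ) k k∈B
    ... | j , j∈♡ , ej | k̄ , k̄∈B , ek =
      τ ∙ (j ∙ k̄) , (j ∙ k̄ , Heart-∙ P' j∈♡ (B , FB , k̄∈B) , λ _ → refl) , (begin
        rn P' (act σ Φ)                  ≡⟨ cong (rn P') (σ≃τk Φ) ⟩
        rn P' (act k (act τ Φ))          ≡⟨ ek ⟩
        act k̄ (rn P' (act τ Φ))          ≡⟨ cong (act k̄) ej ⟩
        act k̄ (act j (act τ (rn P Φ)))   ∎)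

  infix 4 _∼[_]_ _≈[_]_
  _∼[_]_ : Word K → PreExtender K → Word K → Set
  u ∼[ P ] v = _∼⟨_⟩_ K u P v

  _≈[_]_ : UFlag K → PreExtender K → UFlag K → Set
  x ≈[ P ] y = _≈U⟨_⟩_ K x P y

  ≈U-sym : ∀ {P x y} → x ≈[ P ] y → y ≈[ P ] x
  ≈U-sym (e , q) = sym e , ∼sym q

  ≈U-trans : ∀ {P x y z} → x ≈[ P ] y → y ≈[ P ] z → x ≈[ P ] z
  ≈U-trans (e , q) (e' , q') = trans e e' , ∼trans q q'

  ≈U-r : ∀ {P x y} j → x ≈[ P ] y → (r j (proj₁ x) , proj₂ x) ≈[ P ] (r j (proj₁ y) , proj₂ y)
  ≈U-r j (e , q) = cong (r j) e , q

  ∷-cong : ∀ {P l l' u v} → l ≡ l' → u ∼[ P ] v → l ∷ u ∼[ P ] l' ∷ v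
  ∷-cong {l = l} refl q = ∼cong {u = l ∷ []} ∼refl q

  cancel-rel : ∀ {P} Φ w → (true , rn P Φ) ∷ (true , Φ) ∷ w ∼[ P ] w
  cancel-rel {P} Φ w =
    ∼trans (∷-cong refl (∷-cong (cong (true ,_) (sym (rn-invol P Φ))) ∼refl))
           (∼cong {u = (true , rn P Φ) ∷ (true , rn P (rn P Φ)) ∷ []} {u' = []} ∼rel ∼refl)

  -- The letter (false , Φ) stands for α_F⁻¹ = α_{r_n F}.
  positive : PreExtender K → Bool × Flag → Flag
  positive P (true , Φ)  = Φ
  positive P (false , Φ) = rn P Φ

  positive-∼ : ∀ P l w → (true , positive P l) ∷ w ∼[ P ] l ∷ w
  positive-∼ P (true , Φ)  w = ∼refl
  positive-∼ P (false , Φ) w = ∼cong {u = (true , rn P Φ) ∷ []} {u' = (false , Φ) ∷ []} inverse ∼refl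
    where
    inverse : (true , rn P Φ) ∷ [] ∼[ P ] (false , Φ) ∷ []
    inverse = ∼trans (∼cong {u = []} {u' = (false , Φ) ∷ (true , Φ) ∷ []} (∼sym ∼invˡ) ∼refl)
                     (∷-cong refl ∼rel)

  SameFacet-positive : ∀ P b {Φ Ψ} → SameFacet Φ Ψ →
                       SameFacet (positive P (b , Φ)) (positive P (b , Ψ))
  SameFacet-positive P true  sf = sf
  SameFacet-positive P false sf = SameFacet-map (rn-comm P) sf

  -- Words are read from the right: the leftmost letter is the one added last by r_n.
  module Transducer (P P' : PreExtender K) {S : Aut K → Set} (F : Friendly K (rn P) (rn P') S) where

    record State : Set where
      constructor ⟨_,_,_⟩
      field
        aut   : Aut K
        aut∈S : S aut
        out   : Word K
    open State public

    start : (τ : Aut K) → S τ → State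
    start τ τ∈S = ⟨ τ , τ∈S , [] ⟩

    push : Flag → State → State
    push Z x = ⟨ proj₁ (F Z (aut x) (aut∈S x)) , proj₁ (proj₂ (F Z (aut x) (aut∈S x)))
               , (true , act (aut x) Z) ∷ out x ⟩

    push-aut : ∀ Z x → rn P' (act (aut x) Z) ≡ act (aut (push Z x)) (rn P Z)
    push-aut Z x = proj₂ (proj₂ (F Z (aut x) (aut∈S x)))

    run : Word K → State → State
    run []      x = x
    run (l ∷ w) x = push (positive P l) (run w x)

    run-++ : ∀ u v x → run (u ++ v) x ≡ run u (run v x)
    run-++ []      v x = refl
    run-++ (l ∷ u) v x = cong (push (positive P l)) (run-++ u v x)

    infix 4 _≈ₛ_
    record _≈ₛ_ (x y : State) : Set where
      constructor _,_
      field
        aut≃ : aut x ≃ aut y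
        out∼ : out x ∼[ P' ] out y

    ≈ₛ-refl : ∀ {x} → x ≈ₛ x
    ≈ₛ-refl = (λ _ → refl) , ∼refl

    ≈ₛ-sym : ∀ {x y} → x ≈ₛ y → y ≈ₛ x
    ≈ₛ-sym (e , q) = (λ Φ → sym (e Φ)) , ∼sym q

    ≈ₛ-trans : ∀ {x y z} → x ≈ₛ y → y ≈ₛ z → x ≈ₛ z
    ≈ₛ-trans (e , q) (e' , q') = (λ Φ → trans (e Φ) (e' Φ)) , ∼trans q q'

    -- Both Φ ↦ r_n'(Φ aut x) and Φ ↦ (r_n Φ)(aut (push Z x)) commute with the facet
    -- colours and agree at Z, hence on the whole facet of Z.
    push-facet : ∀ {Z Z' x y} → SameFacet Z Z' → x ≈ₛ y → push Z x ≈ₛ push Z' y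
    push-facet {Z} {Z'} {x} {y} sf (x≃y , o∼o') =
        ≃-at-flag (aut (push Z x)) (aut (push Z' y)) (rn P Z') (begin
          act (aut (push Z x)) (rn P Z')
            ≡⟨ agree-on-facet (∘-commutes (act-commutes (aut (push Z x))) (rn-comm P))
                              (∘-commutes (rn-comm P') (act-commutes (aut x)))
                              (sym (push-aut Z x)) sf ⟩
          rn P' (act (aut x) Z')          ≡⟨ cong (rn P') (x≃y Z') ⟩
          rn P' (act (aut y) Z')          ≡⟨ push-aut Z' y ⟩
          act (aut (push Z' y)) (rn P Z') ∎)
      , ∼cong {u = (true , act (aut x) Z) ∷ []} {u' = (true , act (aut y) Z') ∷ []}
          (∼facet (subst (SameFacet (act (aut x) Z)) (x≃y Z') (SameFacet-map (act-commutes (aut x)) sf)))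
          o∼o'

    push-pair : ∀ {X Y} → Y ≡ rn P X → ∀ x → push Y (push X x) ≈ₛ x
    push-pair {X} {Y} refl x =
        ≃-at-flag (aut x₂) (aut x) (rn P Y) (begin
          act (aut x₂) (rn P Y)             ≡⟨ push-aut Y x₁ ⟨
          rn P' (act (aut x₁) Y)            ≡⟨ cong (rn P') out-letter ⟩
          rn P' (rn P' (act (aut x) X))     ≡⟨ rn-invol P' _ ⟩
          act (aut x) X                     ≡⟨ cong (act (aut x)) (rn-invol P X) ⟨
          act (aut x) (rn P Y)              ∎)
      , ∼trans (∷-cong (cong (true ,_) out-letter) ∼refl) (cancel-rel (act (aut x) X) (out x))
      where
      x₁ = push X x
      x₂ = push Y x₁
      out-letter : act (aut x₁) Y ≡ rn P' (act (aut x) X)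
      out-letter = sym (push-aut X x)

    run-cong : ∀ w {x y} → x ≈ₛ y → run w x ≈ₛ run w y
    run-cong []      x≈y = x≈y
    run-cong (l ∷ w) x≈y = push-facet SameFacet-refl (run-cong w x≈y)

    run-resp : ∀ {u v x y} → u ∼[ P ] v → x ≈ₛ y → run u x ≈ₛ run v y
    run-resp {u} ∼refl x≈y = run-cong u x≈y
    run-resp (∼sym q) x≈y = ≈ₛ-sym (run-resp q (≈ₛ-sym x≈y))
    run-resp (∼trans q q') x≈y = ≈ₛ-trans (run-resp q x≈y) (run-resp q' ≈ₛ-refl)
    run-resp {x = x} {y} (∼cong {u = u} {u'} {v} {v'} q q') x≈y
      rewrite run-++ u v x | run-++ u' v' y = run-resp q (run-resp q' x≈y)
    run-resp (∼facet {b = b} sf) x≈y = push-facet (SameFacet-positive P b sf) x≈y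
    run-resp (∼invʳ {Φ = Φ}) x≈y = ≈ₛ-trans (push-pair (sym (rn-invol P Φ)) _) x≈y
    run-resp ∼invˡ x≈y = ≈ₛ-trans (push-pair refl _) x≈y
    run-resp (∼rel {Φ = Φ}) x≈y = ≈ₛ-trans (push-pair (sym (rn-invol P Φ)) _) x≈y

    transduce : (τ : Aut K) → S τ → UFlag K → UFlag K
    transduce τ τ∈S (Φ , w) = act (aut (run w (start τ τ∈S))) Φ , out (run w (start τ τ∈S))

    transduce-cong : ∀ τ τ∈S {x y} → x ≈[ P ] y → transduce τ τ∈S x ≈[ P' ] transduce τ τ∈S y
    transduce-cong τ τ∈S {Φ , u} (refl , q) with run-resp q (≈ₛ-refl {start τ τ∈S})
    ... | e , q' = e Φ , q'

    transduce-r : ∀ τ τ∈S i x → transduce τ τ∈S (rU K P i x) ≈[ P' ] rU K P' i (transduce τ τ∈S x)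
    transduce-r τ τ∈S i (Φ , w) with view i
    ... | ‵fromℕ     rewrite rU-fromℕ P | rU-fromℕ P' =
      sym (push-aut Φ (run w (start τ τ∈S))) , ∼refl
    ... | ‵inject₁ j rewrite rU-inject₁ P j | rU-inject₁ P' j =
      act-r (aut (run w (start τ τ∈S))) j Φ , ∼refl

  module RoundTrip {P P' : PreExtender K} {S S' : Aut K → Set}
                   (F : Friendly K (rn P) (rn P') S) (F' : Friendly K (rn P') (rn P) S') where
    module M  = Transducer P P' F
    module M' = Transducer P' P F'

    round-trip : ∀ τ τ∈S σ σ∈S' → τ ∙ σ ≃ 1A →
                 ∀ x → M'.transduce σ σ∈S' (M.transduce τ τ∈S x) ≈[ P ] x
    round-trip τ τ∈S σ σ∈S' τσ≃1 (Φ , w) = proj₁ (invariant w) Φ , proj₂ (invariant w)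
      where
      forth : Word K → M.State
      forth w = M.run w (M.start τ τ∈S)

      back : Word K → M'.State
      back w = M'.run (M.out (forth w)) (M'.start σ σ∈S')

      invariant : ∀ w → M.aut (forth w) ∙ M'.aut (back w) ≃ 1A × M'.out (back w) ∼[ P ] w
      invariant []      = τσ≃1 , ∼refl
      invariant (l ∷ w) =
          ≃-at-flag (τ₂ ∙ σ₂) 1A (rn P Z) (begin
            act σ₂ (act τ₂ (rn P Z))   ≡⟨ cong (act σ₂) (M.push-aut Z (forth w)) ⟨
            act σ₂ (rn P' (act τ₁ Z))  ≡⟨ M'.push-aut (act τ₁ Z) (back w) ⟨
            rn P (act σ₁ (act τ₁ Z))   ≡⟨ cong (rn P) (proj₁ (invariant w) Z) ⟩
            rn P Z                     ∎)
        , ∼trans (∷-cong (cong (true ,_) (proj₁ (invariant w) Z)) (proj₂ (invariant w)))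
                 (positive-∼ P l w)
        where
        Z = positive P l
        τ₁ = M.aut (forth w)
        σ₁ = M'.aut (back w)
        τ₂ = M.aut (forth (l ∷ w))
        σ₂ = M'.aut (back (l ∷ w))

  friendly⇒UIso : ∀ P P' → HasFriendlySet (rn P) (rn P') → UIso K P P'
  friendly⇒UIso P P' (S , (τ₀ , τ₀∈S) , F) = record
    { to        = R.M.transduce τ₀ τ₀∈S
    ; from      = R.M'.transduce (τ₀ ⁻¹) τ₀⁻¹∈S⁻¹
    ; to-cong   = R.M.transduce-cong τ₀ τ₀∈S
    ; from-cong = R.M'.transduce-cong (τ₀ ⁻¹) τ₀⁻¹∈S⁻¹
    ; to-from   = R'.round-trip (τ₀ ⁻¹) τ₀⁻¹∈S⁻¹ τ₀ τ₀∈S (act-inv τ₀)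
    ; from-to   = R.round-trip τ₀ τ₀∈S (τ₀ ⁻¹) τ₀⁻¹∈S⁻¹ (inv-act τ₀)
    ; to-r      = R.M.transduce-r τ₀ τ₀∈S
    }
    where
    F⁻¹ : Friendly K (rn P') (rn P) (S ⁻¹ˢ)
    F⁻¹ = ⁻¹ˢ-friendly (rn P) (rn P') F

    module R  = RoundTrip F F⁻¹
    module R' = RoundTrip F⁻¹ F

    τ₀⁻¹∈S⁻¹ : (S ⁻¹ˢ) (τ₀ ⁻¹)
    τ₀⁻¹∈S⁻¹ = τ₀ , τ₀∈S , λ _ → refl

  LowerColoursPreserved : PreExtender K → (UFlag K → UFlag K) → Set
  LowerColoursPreserved P' f =
    ∀ j Φ γ → f (r j Φ , γ) ≈[ P' ] (r j (proj₁ (f (Φ , γ))) , proj₂ (f (Φ , γ)))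

  word-independent : ∀ {P'} f → LowerColoursPreserved P' f →
                     ∀ γ Φ Ψ → proj₂ (f (Φ , γ)) ∼[ P' ] proj₂ (f (Ψ , γ))
  word-independent {P'} f preserved γ Φ Ψ with connected Φ Ψ
  ... | w , refl = along w Φ
    where
    along : ∀ w Φ → proj₂ (f (Φ , γ)) ∼[ P' ] proj₂ (f (applyW w Φ , γ))
    along []      Φ = ∼refl
    along (i ∷ w) Φ = ∼trans (∼sym (proj₂ (preserved i Φ γ))) (along w (r i Φ))

  module FromIso {P P' : PreExtender K} (I : UIso K P P') where
    open UIso I

    to-lower : LowerColoursPreserved P' to
    to-lower j Φ γ with to-r (inject₁ j) (Φ , γ)
    ... | e rewrite rU-inject₁ P j | rU-inject₁ P' j = e

    from-lower : LowerColoursPreserved P from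
    from-lower j Ψ δ =
      ≈U-trans (from-cong (≈U-trans (≈U-r j (≈U-sym (to-from (Ψ , δ)))) (≈U-sym (to-lower j _ _))))
               (from-to _)

    to-top : ∀ Φ γ → proj₁ (to (rn P Φ , (true , Φ) ∷ γ)) ≡ rn P' (proj₁ (to (Φ , γ)))
    to-top Φ γ with to-r (fromℕ n) (Φ , γ)
    ... | e rewrite rU-fromℕ P | rU-fromℕ P' = proj₁ e

    τ[_] : Word K → Aut K
    τ[ γ ] = record
      { act = act-γ ; inv = inv-γ ; act-inv = act-inv-γ ; inv-act = inv-act-γ
      ; act-r = λ j Φ → proj₁ (to-lower j Φ γ)
      }
      where
      act-γ : Flag → Flag
      act-γ Φ = proj₁ (to (Φ , γ))

      inv-γ : Flag → Flag
      inv-γ Ψ = proj₁ (from (Ψ , proj₂ (to (Ψ , γ))))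

      back-word : ∀ Ψ → proj₂ (from (Ψ , proj₂ (to (Ψ , γ)))) ∼[ P ] γ
      back-word Ψ = ∼trans (word-independent from from-lower (proj₂ (to (Ψ , γ))) Ψ _)
                           (proj₂ (from-to (Ψ , γ)))

      act-inv-γ : ∀ Ψ → act-γ (inv-γ Ψ) ≡ Ψ
      act-inv-γ Ψ = trans (proj₁ (to-cong (refl , ∼sym (back-word Ψ))))
                          (proj₁ (to-from (Ψ , proj₂ (to (Ψ , γ)))))

      inv-act-γ : ∀ Φ → inv-γ (act-γ Φ) ≡ Φ
      inv-act-γ Φ = trans (proj₁ (from-cong (refl , word-independent to to-lower γ _ Φ)))
                          (proj₁ (from-to (Φ , γ)))

    Image : Aut K → Set
    Image σ = Σ (Word K) λ γ → σ ≃ τ[ γ ]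

    image-friendly : Friendly K (rn P) (rn P') Image
    image-friendly Φ σ (γ , σ≃) =
      τ[ (true , Φ) ∷ γ ] , ((true , Φ) ∷ γ , λ _ → refl) ,
      trans (cong (rn P') (σ≃ Φ)) (sym (to-top Φ γ))

  UIso⇒friendly : ∀ P P' → UIso K P P' → HasFriendlySet (rn P) (rn P')
  UIso⇒friendly P P' I = Image , (τ[ [] ] , [] , λ _ → refl) , image-friendly
    where open FromIso I

theorem5p24 : {n : ℕ} (K : Maniplex n) (P P' : PreExtender K) →
    (UIso K P P' ⇔ Σ (Aut K → Set) (λ S → Σ (Aut K) S × Friendly K (PreExtender.rn P) (PreExtender.rn P') S))
    × (Σ (Aut K → Set) (λ S → Σ (Aut K) S × Friendly K (PreExtender.rn P) (PreExtender.rn P') S)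
       ⇔ Σ (Aut K) (λ τ → QuotEq K (conjR K τ (PreExtender.rn P)) (ConjSet K (Heart K P) τ) (PreExtender.rn P') (Heart K P')))
theorem5p24 K P P' =
  mk⇔ (UIso⇒friendly K P P') (friendly⇒UIso K P P') , mk⇔ (friendly⇒QuotEq K P P') (QuotEq⇒friendly K P P')
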